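{- Let $X\subseteq\{0,1\}^n$ be nonempty. For any tiebreaking rule and any initial vertex $\tilde x\in X$, Algorithm P* computes a genlex Hamilton path on the skeleton of $\mathrm{conv}(X)$ starting at $\tilde x$.
   Context: For distinct $x,y\in\{0,1\}^n$ let $\lambda(x,y):=\max\{i\in[n]:x_i\ne y_i\}$ and $d(x,y):=|\{i:x_i\ne y_i\}|$ (Hamming distance). For an interval (set of consecutive integers) $I\subseteq[n]$ let $\lambda_I(x,y):=\lambda(x,y)$ if $\lambda(x,y)\in I$, and $\infty$ otherwise. The skeleton of $\mathrm{conv}(X)$ is the graph of its vertices (which are the elements of $X$) and edges. An ordering of $X$ is genlex if for every $k$ all elements with the same suffix of length $k$ appear consecutively; a genlex Hamilton path is a Hamilton path whose vertex sequence is genlex. A tiebreaking rule selects one element from a given nonempty set $N\subseteq X$ (possibly depending on the algorithm's state). Algorithm P* (input $X$, $\tilde x$, tiebreaking rule) keeps a current vertex $x$, a stack $U$ of intervals, and a value $\beta_I$ for each $I$ on $U$. Subroutine branching$(I)$: compute $\beta:=\min\{\lambda_I(x,y):y\in X\setminus\{x\}\}$ (min of empty set is $\infty$); if $\beta<\infty$ set $\beta_I:=\beta$ and push $I$ onto $U$. Steps: (P1) $x:=\tilde x$, call branching$([n])$. (P2) Visit $x$. (P3) If $U$ is empty terminate; else pop $I$ from $U$, set $\beta:=\beta_I$. (P4) Let $N$ be the set of $y\in X\setminus\{x\}$ with $\lambda(x,y)=\beta$ minimizing $d(x,y)$ among such $y$. (P5) Pick $y\in N$ by the tiebreaking rule,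 set $x:=y$. (P6) Call branching$(I\setminus[\beta])$, then branching$([\beta-1])$ (with $[0]=\emptyset$), go to (P2). -}

module Defs where

open import Data.Bool using (Bool; true; false)
import Data.Bool.Properties as BoolP
open import Data.Nat using (ℕ; zero; suc; _≤_; _<_; _∸_; _⊔_; _⊓_; _≤?_)
import Data.Nat.Properties as ℕP
open import Data.Integer as ℤ using (ℤ)
open import Data.Fin as Fin using (Fin; toℕ)
open import Data.List using (List; []; _∷_; filter; map; length; foldr; reverse; allFin; lookup)
open import Data.List.Membership.Propositional using (_∈_)
open import Data.List.Relation.Unary.Unique.Propositional using (Unique)
open import Data.List.Relation.Unary.Linked using (Linked)
open import Data.Vec as Vec using (Vec)
import Data.Vec.Properties as VecP
open import Data.Maybe using (Maybe; just; nothing)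
open import Data.Product using (_×_; _,_; ∃; ∃-syntax)
open import Relation.Binary.PropositionalEquality using (_≡_; _≢_)
open import Relation.Nullary using (¬?; _×-dec_)
open import Relation.Binary using (DecidableEquality)

-- Points of {0,1}^n.  Coordinate i ∈ [n] = {1,…,n} of x is
-- Vec.lookup x j with toℕ j + 1 = i.

V : ℕ → Set
V n = Vec Bool n

_≟V_ : ∀ {n} → DecidableEquality (V n)
_≟V_ = VecP.≡-dec BoolP._≟_

diffIdx : ∀ {n} → V n → V n → List ℕ
diffIdx {n} x y =
  map (λ j → suc (toℕ j))
      (filter (λ j → ¬? (Vec.lookup x j BoolP.≟ Vec.lookup y j)) (allFin n))

-- λ(x,y) = max{ i : x_i ≠ y_i }  (only used for x ≠ y; equals 0 if x = y)
lam : ∀ {n} → V n → V n → ℕ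
lam x y = foldr _⊔_ 0 (diffIdx x y)

ham : ∀ {n} → V n → V n → ℕ
ham x y = length (diffIdx x y)

record Interval : Set where
  constructor [_⋯_]
  field
    lo hi : ℕ
open Interval public

_∈I?_ : (i : ℕ) (I : Interval) → Relation.Nullary.Dec (lo I ≤ i × i ≤ hi I)
i ∈I? I = (lo I ≤? i) ×-dec (i ≤? hi I)

upto : ℕ → Interval
upto m = [ 1 ⋯ m ]

-- I \ [β]
minusUpto : Interval → ℕ → Interval
minusUpto I β = [ lo I ⊔ suc β ⋯ hi I ]

others : ∀ {n} → List (V n) → V n → List (V n)
others X x = filter (λ y → ¬? (y ≟V x)) X

Stack : Set
Stack = List (Interval × ℕ)   -- intervals I with their values β_I (top = head)

-- branching(I) at current vertex x: β = min { λ_I(x,y) : y ∈ X \ {x} }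
-- (λ_I = λ if λ ∈ I, ∞ otherwise); push (I , β) if β < ∞.
branching : ∀ {n} → List (V n) → V n → Interval → Stack → Stack
branching X x I U with filter (λ b → b ∈I? I) (map (lam x) (others X x))
... | []     = U
... | b ∷ bs = (I , foldr _⊓_ b bs) ∷ U

nearSet : ∀ {n} → List (V n) → V n → ℕ → List (V n)
nearSet X x β with filter (λ y → lam x y ℕP.≟ β) (others X x)
... | []     = []
... | m ∷ ms = filter (λ y → ham x y ℕP.≟ dmin) (m ∷ ms)
  where dmin = foldr _⊓_ (ham x m) (map (ham x) ms)

-- The state of the algorithm at the moment of the tiebreaking decision (P5):
-- vertices visited so far (in order), current vertex, popped interval I and
-- its value β, and the remaining stack.
record State (n : ℕ) : Set where
  constructor mkState
  field
    visited : List (V n)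
    current : V n
    popped  : Interval
    beta    : ℕ
    rest    : Stack

-- A tiebreaking rule: selects an element of N (depending on the state).
Rule : ℕ → Set
Rule n = State n → List (V n) → V n

ValidRule : ∀ {n} → Rule n → Set
ValidRule {n} rule = ∀ (s : State n) (z : V n) (zs : List (V n)) → rule s (z ∷ zs) ∈ z ∷ zs

-- main loop (P2)–(P6), with fuel; acc = visited vertices in reverse order.
-- Returns nothing if fuel runs out (or if N were ever empty).
loopP : ∀ {n} → List (V n) → Rule n → ℕ → List (V n) → V n → Stack → Maybe (List (V n))
loopP X rule zero    acc x U = nothing
loopP X rule (suc k) acc x [] = just (reverse (x ∷ acc))
loopP X rule (suc k) acc x ((I , β) ∷ U) with nearSet X x β
... | []     = nothing
... | z ∷ zs =
  let y = rule (mkState (reverse (x ∷ acc)) x I β U) (z ∷ zs)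
  in loopP X rule k (x ∷ acc) y
       (branching X y (upto (β ∸ 1)) (branching X y (minusUpto I β) U))

algorithmP* : ∀ {n} → List (V n) → Rule n → V n → ℕ → Maybe (List (V n))
algorithmP* {n} X rule x̃ fuel = loopP X rule fuel [] x̃ (branching X x̃ (upto n) [])

-- Skeleton of conv(X): {x,y} (x ≠ y) is an edge iff it is a face, i.e. some
-- linear functional c attains its maximum over X exactly at x and y.

dot : ∀ {n} → Vec ℤ n → V n → ℤ
dot Vec.[] Vec.[] = ℤ.0ℤ
dot (c Vec.∷ cs) (true  Vec.∷ xs) = c ℤ.+ dot cs xs
dot (c Vec.∷ cs) (false Vec.∷ xs) = dot cs xs

SkeletonEdge : ∀ {n} → List (V n) → V n → V n → Set
SkeletonEdge {n} X x y =
  x ∈ X × y ∈ X × x ≢ y ×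
  ∃[ c ] (dot c x ≡ dot c y ×
          (∀ z → z ∈ X → z ≢ x → z ≢ y → dot c z ℤ.< dot c x))

HamiltonPath : ∀ {n} → List (V n) → List (V n) → Set
HamiltonPath X P =
  Unique P × (∀ z → z ∈ P → z ∈ X) × (∀ z → z ∈ X → z ∈ P) × Linked (SkeletonEdge X) P

-- x and y have the same suffix of length k (coordinates n-k+1,…,n)
SameSuffix : ∀ {n} → ℕ → V n → V n → Set
SameSuffix {n} k x y = ∀ (j : Fin n) → n ∸ k ≤ toℕ j → Vec.lookup x j ≡ Vec.lookup y j

Genlex : ∀ {n} → List (V n) → Set
Genlex P = ∀ (k : ℕ) (i j l : Fin (length P)) → i Fin.≤ j → j Fin.≤ l →
  SameSuffix k (lookup P i) (lookup P l) → SameSuffix k (lookup P i) (lookup P j)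

{-# OPTIONS --safe #-}

-- λ is an ultrametric on {0,1}^n, and since the alphabet is binary two points at the same
-- distance λ from x agree at coordinate λ, hence are strictly closer to each other.
--
-- Let y be a Hamming-nearest point of X among those with λ(x,y) = β, and let W be the
-- number of coordinates below β where x and y differ.  The functional rewarding agreement with
-- y at β by W, agreement with x by W+1 where x and y agree and by 1 at the other coordinates,
-- takes the same value at x and y, and any other z ∈ X scores less: either z leaves x where x
-- and y agree (losing W+1, gaining at most W), or z keeps x_β and loses somewhere, or else z
-- has λ(x,z) = β and is Hamming-closer to x than y, which the choice of y excludes.
--
-- With x the current vertex, z ∈ X is unvisited iff λ(x,z) lies in an interval on
-- the stack; along the visited sequence v₀ v₁ … the value λ(vᵢ, vⱼ) is nondecreasing in j and
-- bounded by λ(vᵢ, z) for unvisited z.  Each step moves to a point y with λ(x,y) = β, the least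
-- pending distance, and the ultrametric inequality re-establishes all three properties for y.
-- Monotonicity is exactly genlex, an empty stack means every vertex was visited, and each step
-- visits a new vertex, so |X| + 1 units of fuel suffice.
module Submission where

open import Defs
open import Data.Bool using (Bool; true; false)
import Data.Bool.Properties as BoolP
open import Data.Nat using (ℕ; zero; suc; _+_; _≤_; _<_; _∸_; _⊔_; _⊓_; z≤n; s≤s; s≤s⁻¹; _≤?_)
open import Data.Nat.Properties
open import Data.Integer as ℤ using (ℤ; +_; +<+)
import Data.Integer.Properties as ℤP
open import Algebra.Bundles using (AbelianGroup)
open import Algebra.Properties.CommutativeSemigroup ℤP.+-commutativeSemigroup using (interchange)
open import Algebra.Properties.Group (AbelianGroup.group ℤP.+-0-abelianGroup) using (∙-cancelʳ)
open import Algebra.Properties.CommutativeMonoid.Sum +-0-commutativeMonoid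
  using (sum; sum-cong-≗; ∑-distrib-+; sum-remove)
open import Data.Fin as Fin using (Fin; toℕ)
open import Data.Fin.Patterns using (0F)
import Data.Fin.Properties as FinP
open import Data.Vec.Functional using (Vector; tail; removeAt)
import Data.Vec as Vec
import Data.Vec.Properties as VecP
open import Data.List using (List; []; _∷_; _∷ʳ_; foldr; map; filter; length; lookup; reverse; allFin)
open import Data.List.Properties using (length-map; length-filter; unfold-reverse)
open import Data.List.Membership.Propositional using (_∈_; _∉_)
open import Data.List.Membership.Propositional.Properties
  using (∈-filter⁺; ∈-filter⁻; ∈-map⁺; ∈-map⁻; ∈-allFin; ∈-++⁺ˡ; ∈-++⁺ʳ; ∈-++⁻; foldr-selective)
open import Data.List.Relation.Unary.Any using (Any; here; there)
open import Data.List.Relation.Unary.Any.Properties using (¬Any[])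
open import Data.List.Relation.Unary.All as All using (All; []; _∷_)
open import Data.List.Relation.Unary.AllPairs as AllPairs using (AllPairs; []; _∷_)
open import Data.List.Relation.Unary.Linked using (Linked; [-]; _∷_)
open import Data.List.Relation.Unary.Unique.Propositional using (Unique)
import Data.List.Relation.Unary.Unique.Propositional.Properties as Unique
open import Data.Maybe using (Maybe; just)
open import Data.Product using (_×_; _,_; ∃-syntax; proj₁; proj₂)
open import Data.Sum using (_⊎_; inj₁; inj₂; [_,_]′)
open import Data.Sum.Function.Propositional using (_⊎-⇔_)
open import Function using (_∘_; id; _⇔_; mk⇔; Equivalence)
import Function.Properties.Equivalence as ⇔
open import Relation.Binary using (tri<; tri≈; tri>)
open import Relation.Nullary using (¬_; ¬?; Dec; yes; no; contradiction; _×-dec_)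
open import Relation.Nullary.Decidable using (decidable-stable)
open import Relation.Unary using (Decidable)
open import Relation.Binary.PropositionalEquality
  using (_≡_; _≢_; refl; sym; trans; cong; cong₂; subst; subst₂; module ≡-Reasoning)

open Equivalence using (to; from)

-- Lists and finite sums

foldr-⊔-upper : ∀ {a} (xs : List ℕ) → a ∈ xs → a ≤ foldr _⊔_ 0 xs
foldr-⊔-upper (b ∷ xs) (here refl) = m≤m⊔n b _
foldr-⊔-upper (b ∷ xs) (there p)   = ≤-trans (foldr-⊔-upper xs p) (m≤n⊔m b _)

foldr-⊔-least : ∀ {m} (xs : List ℕ) → (∀ {a} → a ∈ xs → a ≤ m) → foldr _⊔_ 0 xs ≤ m
foldr-⊔-least []       h = z≤n
foldr-⊔-least (b ∷ xs) h = ⊔-lub (h (here refl)) (foldr-⊔-least xs (h ∘ there))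


foldr-⊓-lower : ∀ {a} b (xs : List ℕ) → a ∈ b ∷ xs → foldr _⊓_ b xs ≤ a
foldr-⊓-lower b []       (here refl)         = ≤-refl
foldr-⊓-lower b (c ∷ xs) (here refl)         = ≤-trans (m⊓n≤n c _) (foldr-⊓-lower b xs (here refl))
foldr-⊓-lower b (c ∷ xs) (there (here refl)) = m⊓n≤m c _
foldr-⊓-lower b (c ∷ xs) (there (there p))   = ≤-trans (m⊓n≤n c _) (foldr-⊓-lower b xs (there p))

foldr-⊓-∈ : ∀ b (xs : List ℕ) → foldr _⊓_ b xs ∈ b ∷ xs
foldr-⊓-∈ b xs with foldr-selective ⊓-sel b xs
... | inj₁ e = here e
... | inj₂ p = there p


module _ {A : Set} {P Q : A → Set} (P? : Decidable P) (Q? : Decidable Q)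
         (P⇒Q : ∀ {a} → P a → Q a) where

  length-filter-mono : ∀ xs → length (filter P? xs) ≤ length (filter Q? xs)
  length-filter-mono []       = z≤n
  length-filter-mono (a ∷ xs) with P? a | Q? a
  ... | yes p | yes q = s≤s (length-filter-mono xs)
  ... | yes p | no ¬q = contradiction (P⇒Q p) ¬q
  ... | no ¬p | yes q = m≤n⇒m≤1+n (length-filter-mono xs)
  ... | no ¬p | no ¬q = length-filter-mono xs

  length-filter-mono-< : ∀ {a} xs → a ∈ xs → Q a → ¬ P a →
                         length (filter P? xs) < length (filter Q? xs)
  length-filter-mono-< (b ∷ xs) (here refl) qa ¬pa with P? b | Q? b
  ... | yes p | _     = contradiction p ¬pa
  ... | no ¬p | yes q = s≤s (length-filter-mono xs)
  ... | no ¬p | no ¬q = contradiction qa ¬q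
  length-filter-mono-< (b ∷ xs) (there a∈xs) qa ¬pa with P? b | Q? b
  ... | yes p | yes q = s≤s (length-filter-mono-< xs a∈xs qa ¬pa)
  ... | yes p | no ¬q = contradiction (P⇒Q p) ¬q
  ... | no ¬p | yes q = m≤n⇒m≤1+n (length-filter-mono-< xs a∈xs qa ¬pa)
  ... | no ¬p | no ¬q = length-filter-mono-< xs a∈xs qa ¬pa


sum-mono-≤ : ∀ {n} {f g : Vector ℕ n} → (∀ j → f j ≤ g j) → sum f ≤ sum g
sum-mono-≤ {zero}  f≤g = z≤n
sum-mono-≤ {suc n} f≤g = +-mono-≤ (f≤g 0F) (sum-mono-≤ (f≤g ∘ Fin.suc))

sum-mono-+-≤ : ∀ {n} {f g : Vector ℕ n} i {k} → (∀ j → f j ≤ g j) → f i + k ≤ g i →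
               sum f + k ≤ sum g
sum-mono-+-≤ {suc n} {f} {g} 0F {k} f≤g fi+k≤gi = begin
  (f 0F + sum (tail f)) + k  ≡⟨ +-assoc (f 0F) _ k ⟩
  f 0F + (sum (tail f) + k)  ≡⟨ cong (_+_ (f 0F)) (+-comm _ k) ⟩
  f 0F + (k + sum (tail f))  ≡⟨ +-assoc (f 0F) k _ ⟨
  (f 0F + k) + sum (tail f)  ≤⟨ +-mono-≤ fi+k≤gi (sum-mono-≤ (f≤g ∘ Fin.suc)) ⟩
  g 0F + sum (tail g)        ∎
  where open ≤-Reasoning
sum-mono-+-≤ {suc n} {f} {g} (Fin.suc i) {k} f≤g fi+k≤gi = begin
  (f 0F + sum (tail f)) + k  ≡⟨ +-assoc (f 0F) _ k ⟩
  f 0F + (sum (tail f) + k)  ≤⟨ +-mono-≤ (f≤g 0F) (sum-mono-+-≤ i (f≤g ∘ Fin.suc) fi+k≤gi) ⟩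
  g 0F + sum (tail g)        ∎
  where open ≤-Reasoning

sum-single : ∀ {n} {f : Vector ℕ n} i → (∀ j → j ≢ i → f j ≡ 0) → sum f ≡ f i
sum-single {suc n} {f} i f≡0 = begin
  sum f                      ≡⟨ sum-remove {i = i} f ⟩
  f i + sum (removeAt f i)   ≡⟨ cong (_+_ (f i)) (sum-zero (λ j → f≡0 _ (FinP.punchInᵢ≢i i j))) ⟩
  f i + 0                    ≡⟨ +-identityʳ (f i) ⟩
  f i                        ∎
  where
  open ≡-Reasoning
  sum-zero : ∀ {m} {g : Vector ℕ m} → (∀ j → g j ≡ 0) → sum g ≡ 0
  sum-zero {zero}  g≡0 = refl
  sum-zero {suc m} g≡0 = cong₂ _+_ (g≡0 0F) (sum-zero (g≡0 ∘ Fin.suc))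


data _[_]=_ {A : Set} : List A → ℕ → A → Set where
  at0 : ∀ {a xs} → (a ∷ xs) [ 0 ]= a
  atS : ∀ {a b xs i} → xs [ i ]= a → (b ∷ xs) [ suc i ]= a

module _ {A : Set} where

  []=-lookup : ∀ (xs : List A) i → xs [ toℕ i ]= lookup xs i
  []=-lookup (a ∷ xs) Fin.zero    = at0
  []=-lookup (a ∷ xs) (Fin.suc i) = atS ([]=-lookup xs i)

  []=⇒< : ∀ {xs : List A} {i a} → xs [ i ]= a → i < length xs
  []=⇒< at0     = s≤s z≤n
  []=⇒< (atS p) = s≤s ([]=⇒< p)

  []=-last : ∀ (xs : List A) {y} → (xs ∷ʳ y) [ length xs ]= y
  []=-last []       = at0
  []=-last (a ∷ xs) = atS ([]=-last xs)

  []=-∷ʳ⁻ : ∀ (xs : List A) {y i a} → (xs ∷ʳ y) [ i ]= a → xs [ i ]= a ⊎ (i ≡ length xs × a ≡ y)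
  []=-∷ʳ⁻ []       at0       = inj₂ (refl , refl)
  []=-∷ʳ⁻ (b ∷ xs) at0       = inj₁ at0
  []=-∷ʳ⁻ (b ∷ xs) (atS p) with []=-∷ʳ⁻ xs p
  ... | inj₁ q              = inj₁ (atS q)
  ... | inj₂ (refl , a≡y)   = inj₂ (refl , a≡y)

  []=-∷ʳ-init : ∀ (xs : List A) {y i a} → (xs ∷ʳ y) [ i ]= a → i < length xs → xs [ i ]= a
  []=-∷ʳ-init xs p i<len with []=-∷ʳ⁻ xs p
  ... | inj₁ q          = q
  ... | inj₂ (refl , _) = contradiction i<len (<-irrefl refl)

  []=-∷ʳ-≤ : ∀ (xs : List A) {y i a} → (xs ∷ʳ y) [ i ]= a → i ≤ length xs
  []=-∷ʳ-≤ []       at0     = z≤n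
  []=-∷ʳ-≤ (a ∷ xs) at0     = z≤n
  []=-∷ʳ-≤ (a ∷ xs) (atS p) = s≤s ([]=-∷ʳ-≤ xs p)

  ∉-∷ʳ : ∀ {xs : List A} {y z} → z ∉ xs → z ≢ y → z ∉ xs ∷ʳ y
  ∉-∷ʳ {xs} z∉xs z≢y p with ∈-++⁻ xs p
  ... | inj₁ q        = z∉xs q
  ... | inj₂ (here e) = z≢y e

  Linked-∷ʳ : ∀ {R : A → A → Set} (xs : List A) {x y} →
              Linked R (xs ∷ʳ x) → R x y → Linked R (xs ∷ʳ x ∷ʳ y)
  Linked-∷ʳ []           [-]       r = r ∷ [-]
  Linked-∷ʳ (a ∷ [])     (r′ ∷ [-]) r = r′ ∷ r ∷ [-]
  Linked-∷ʳ (a ∷ b ∷ xs) (r′ ∷ rs) r = r′ ∷ Linked-∷ʳ (b ∷ xs) rs r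

-- The ultrametric λ

module _ {n : ℕ} where

  AgreeFrom : ℕ → V n → V n → Set
  AgreeFrom m x y = ∀ (j : Fin n) → m ≤ toℕ j → Vec.lookup x j ≡ Vec.lookup y j

  Differ : V n → V n → Fin n → Set
  Differ x y j = Vec.lookup x j ≢ Vec.lookup y j

  ∈-diffIdx⁺ : ∀ x y {j} → Differ x y j → suc (toℕ j) ∈ diffIdx x y
  ∈-diffIdx⁺ x y {j} d = ∈-map⁺ (suc ∘ toℕ) (∈-filter⁺ _ (∈-allFin j) d)

  ∈-diffIdx⁻ : ∀ x y {a} → a ∈ diffIdx x y → ∃[ j ] (a ≡ suc (toℕ j) × Differ x y j)
  ∈-diffIdx⁻ x y p with ∈-map⁻ (suc ∘ toℕ) p
  ... | j , q , a≡ = j , a≡ ,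
    proj₂ (∈-filter⁻ (λ j → ¬? (Vec.lookup x j BoolP.≟ Vec.lookup y j)) {xs = allFin n} q)

  differ⇒<lam : ∀ x y {j} → Differ x y j → toℕ j < lam x y
  differ⇒<lam x y d = foldr-⊔-upper (diffIdx x y) (∈-diffIdx⁺ x y d)

  agree⇒lam≤ : ∀ {m} x y → AgreeFrom m x y → lam x y ≤ m
  agree⇒lam≤ {m} x y ag = foldr-⊔-least (diffIdx x y) bound
    where
    bound : ∀ {a} → a ∈ diffIdx x y → a ≤ m
    bound p with ∈-diffIdx⁻ x y p
    ... | j , refl , d with m ≤? toℕ j
    ...   | yes m≤j = contradiction (ag j m≤j) d
    ...   | no m≰j  = ≰⇒> m≰j

  lam≤⇒agree : ∀ {m} x y → lam x y ≤ m → AgreeFrom m x y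
  lam≤⇒agree x y le j m≤j with Vec.lookup x j BoolP.≟ Vec.lookup y j
  ... | yes e = e
  ... | no d  = contradiction (≤-trans (differ⇒<lam x y d) le) (≤⇒≯ m≤j)

  ≡⇐lam≡0 : ∀ {x y} → lam x y ≡ 0 → x ≡ y
  ≡⇐lam≡0 {x} {y} e = begin
    x                            ≡⟨ VecP.tabulate∘lookup x ⟨
    Vec.tabulate (Vec.lookup x)  ≡⟨ VecP.tabulate-cong (λ j → lam≤⇒agree x y (≤-reflexive e) j z≤n) ⟩
    Vec.tabulate (Vec.lookup y)  ≡⟨ VecP.tabulate∘lookup y ⟩
    y                            ∎
    where open ≡-Reasoning

  lam-self : ∀ x → lam x x ≡ 0
  lam-self x = n≤0⇒n≡0 (agree⇒lam≤ x x (λ _ _ → refl))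

  lam-pos : ∀ {x y} → x ≢ y → 0 < lam x y
  lam-pos {x} {y} x≢y with lam x y in e
  ... | zero  = contradiction (≡⇐lam≡0 e) x≢y
  ... | suc _ = s≤s z≤n

  lam≤n : ∀ x y → lam x y ≤ n
  lam≤n x y = agree⇒lam≤ x y (λ j n≤j → contradiction (FinP.toℕ<n j) (≤⇒≯ n≤j))

  lam-sym : ∀ x y → lam x y ≡ lam y x
  lam-sym x y = ≤-antisym (half x y) (half y x)
    where
    half : ∀ x y → lam x y ≤ lam y x
    half x y = agree⇒lam≤ x y (λ j q → sym (lam≤⇒agree y x ≤-refl j q))

  lam-ultra : ∀ x y z → lam x z ≤ lam x y ⊔ lam y z
  lam-ultra x y z = agree⇒lam≤ x z λ j q →
    trans (lam≤⇒agree x y ≤-refl j (≤-trans (m≤m⊔n (lam x y) _) q))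
          (lam≤⇒agree y z ≤-refl j (≤-trans (m≤n⊔m (lam x y) _) q))

  lam-isosceles : ∀ x y z → lam x y < lam y z → lam x z ≡ lam y z
  lam-isosceles x y z lt = ≤-antisym
    (≤-trans (lam-ultra x y z) (≤-reflexive (m≤n⇒m⊔n≡n (<⇒≤ lt))))
    (≮⇒≥ λ xz<yz → ≤⇒≯ (lam-ultra y x z)
      (⊔-lub (subst (_< lam y z) (lam-sym x y) lt) xz<yz))

  lam-top : ∀ {x y} → x ≢ y → ∃[ j ] (suc (toℕ j) ≡ lam x y × Differ x y j)
  lam-top {x} {y} x≢y with foldr-selective ⊔-sel 0 (diffIdx x y)
  ... | inj₁ e = contradiction (≡⇐lam≡0 e) x≢y
  ... | inj₂ p with ∈-diffIdx⁻ x y p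
  ...   | j , e , d = j , sym e , d

  lam-binary : ∀ {x y z} → x ≢ y → x ≢ z → lam x y ≡ lam x z → lam y z < lam x y
  lam-binary {x} {y} {z} x≢y x≢z e with lam-top x≢y | lam-top x≢z
  ... | j , ej , dj | k , ek , dk
    with FinP.toℕ-injective (suc-injective (trans ej (trans e (sym ek))))
  ... | refl = subst (lam y z <_) ej (s≤s (agree⇒lam≤ y z agree))
    where
    agree : AgreeFrom (toℕ j) y z
    agree i j≤i with toℕ j ≟ toℕ i
    ... | yes j≡i rewrite FinP.toℕ-injective j≡i =
      trans (BoolP.¬-not (dj ∘ sym)) (sym (BoolP.¬-not (dk ∘ sym)))
    ... | no j≢i = trans (sym (lam≤⇒agree x y (≤-reflexive (sym ej)) i ji))
                         (lam≤⇒agree x z (≤-reflexive (sym ek)) i ji)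
      where
      ji : toℕ j < toℕ i
      ji = ≤∧≢⇒< j≤i j≢i

  lam-far : ∀ x y z → lam x y < lam x z → lam y z ≡ lam x z
  lam-far x y z lt = lam-isosceles y x z (subst (_< lam x z) (lam-sym x y) lt)

  lam-≤-via : ∀ u x y z → lam u x ≤ lam u z → lam x y ≤ lam x z → lam u y ≤ lam u z
  lam-≤-via u x y z ux≤uz xy≤xz = ≤-trans (lam-ultra u x y) (⊔-lub ux≤uz (begin
    lam x y            ≤⟨ xy≤xz ⟩
    lam x z            ≤⟨ lam-ultra x u z ⟩
    lam x u ⊔ lam u z  ≤⟨ ⊔-lub (≤-trans (≤-reflexive (lam-sym x u)) ux≤uz) ≤-refl ⟩
    lam u z            ∎))
    where open ≤-Reasoning

-- Nearest neighbours span skeleton edges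

gain : Bool → Bool → ℕ → ℕ
gain true  true  w = w
gain false false w = w
gain true  false w = 0
gain false true  w = 0

gain-≡ : ∀ b w → gain b b w ≡ w
gain-≡ true  w = refl
gain-≡ false w = refl

gain-≢ : ∀ {a b} w → a ≢ b → gain a b w ≡ 0
gain-≢ {true}  {true}  w a≢b = contradiction refl a≢b
gain-≢ {true}  {false} w a≢b = refl
gain-≢ {false} {true}  w a≢b = refl
gain-≢ {false} {false} w a≢b = contradiction refl a≢b

gain-≤ : ∀ a b w → gain a b w ≤ w
gain-≤ true  true  w = ≤-refl
gain-≤ true  false w = z≤n
gain-≤ false true  w = z≤n
gain-≤ false false w = ≤-refl

gain-≤-gain-≡ : ∀ a b w → gain a b w ≤ gain b b w
gain-≤-gain-≡ a b w = ≤-trans (gain-≤ a b w) (≤-reflexive (sym (gain-≡ b w)))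

signed : Bool → ℕ → ℤ
signed true  a = + a
signed false a = ℤ.- + a

scaleBit : Bool → ℤ → ℤ
scaleBit true  c = c
scaleBit false c = ℤ.0ℤ

dot-∷ : ∀ {n} c (cs : Vec.Vec ℤ n) b (z : V n) →
        dot (c Vec.∷ cs) (b Vec.∷ z) ≡ scaleBit b c ℤ.+ dot cs z
dot-∷ c cs true  z = refl
dot-∷ c cs false z = sym (ℤP.+-identityˡ (dot cs z))

scaleBit-signed : ∀ b s a → scaleBit b (signed s a) ℤ.+ + gain false s a ≡ + gain b s a
scaleBit-signed true  true  a = cong +_ (+-identityʳ a)
scaleBit-signed true  false a = ℤP.+-inverseˡ (+ a)
scaleBit-signed false true  a = refl
scaleBit-signed false false a = refl

functional : ∀ {n} → Vector ℕ n → Vector Bool n → Vec.Vec ℤ n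
functional w s = Vec.tabulate λ j → signed (s j) (w j)

score : ∀ {n} → Vector ℕ n → Vector Bool n → V n → ℕ
score w s z = sum λ j → gain (Vec.lookup z j) (s j) (w j)

dot-score : ∀ {n} (w : Vector ℕ n) s z →
            dot (functional w s) z ℤ.+ + score w s (Vec.replicate n false) ≡ + score w s z
dot-score w s Vec.[] = refl
dot-score w s (b Vec.∷ z) = begin
  dot (functional w s) (b Vec.∷ z) ℤ.+ (+ g₀ ℤ.+ + F₀)
    ≡⟨ cong (ℤ._+ (+ g₀ ℤ.+ + F₀)) (dot-∷ (signed (s 0F) (w 0F)) _ b z) ⟩
  (scaleBit b (signed (s 0F) (w 0F)) ℤ.+ D) ℤ.+ (+ g₀ ℤ.+ + F₀)
    ≡⟨ interchange (scaleBit b (signed (s 0F) (w 0F))) D (+ g₀) (+ F₀) ⟩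
  (scaleBit b (signed (s 0F) (w 0F)) ℤ.+ + g₀) ℤ.+ (D ℤ.+ + F₀)
    ≡⟨ cong₂ ℤ._+_ (scaleBit-signed b (s 0F) (w 0F)) (dot-score (tail w) (tail s) z) ⟩
  + score w s (b Vec.∷ z) ∎
  where
  open ≡-Reasoning
  g₀ F₀ : ℕ
  g₀ = gain false (s 0F) (w 0F)
  F₀ = score (tail w) (tail s) (Vec.replicate _ false)
  D : ℤ
  D = dot (functional (tail w) (tail s)) z

module _ {n : ℕ} (w : Vector ℕ n) (s : Vector Bool n) where

  dot≡⇐score≡ : ∀ {x y} → score w s x ≡ score w s y →
                dot (functional w s) x ≡ dot (functional w s) y
  dot≡⇐score≡ {x} {y} e = ∙-cancelʳ (+ score w s (Vec.replicate n false)) _ _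
    (trans (dot-score w s x) (trans (cong +_ e) (sym (dot-score w s y))))

  dot<⇐score< : ∀ {x y} → score w s x < score w s y →
                dot (functional w s) x ℤ.< dot (functional w s) y
  dot<⇐score< {x} {y} lt = ℤP.≰⇒> λ y≤x → ℤP.<⇒≱
    (subst₂ ℤ._<_ (sym (dot-score w s x)) (sym (dot-score w s y)) (+<+ lt))
    (ℤP.+-monoˡ-≤ (+ score w s (Vec.replicate n false)) y≤x)

module _ {n : ℕ} where

  differ? : ∀ (x y : V n) → Decidable (Differ x y)
  differ? x y j = ¬? (Vec.lookup x j BoolP.≟ Vec.lookup y j)

  ham-filter : ∀ x y → ham x y ≡ length (filter (differ? x y) (allFin n))
  ham-filter x y = length-map (suc ∘ toℕ) (filter (differ? x y) (allFin n))

  ham-< : ∀ {x y z} → (∀ {j} → Differ x z j → Differ x y j) → ∀ j → Differ x y j → ¬ Differ x z j →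
          ham x z < ham x y
  ham-< {x} {y} {z} sub j dy ¬dz = subst₂ _<_ (sym (ham-filter x z)) (sym (ham-filter x y))
    (length-filter-mono-< (differ? x z) (differ? x y) sub (allFin n) (∈-allFin j) dy ¬dz)

  module EdgeWitness {x y : V n} (x≢y : x ≢ y) where

    j* : Fin n
    j* = proj₁ (lam-top x≢y)

    j*-differ : Differ x y j*
    j*-differ = proj₂ (proj₂ (lam-top x≢y))

    data Role (j : Fin n) : Set where
      top   : j ≡ j* → Role j
      agree : j ≢ j* → Vec.lookup x j ≡ Vec.lookup y j → Role j
      low   : j ≢ j* → Differ x y j → Role j

    role : ∀ j → Role j
    role j with j FinP.≟ j* | Vec.lookup x j BoolP.≟ Vec.lookup y j
    ... | yes e | _     = top e
    ... | no ne | yes e = agree ne e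
    ... | no ne | no d  = low ne d

    lowCount : Vector ℕ n
    lowCount j with role j
    ... | low _ _ = 1
    ... | _       = 0

    W : ℕ
    W = sum lowCount

    preferred : Vector Bool n
    preferred j with role j
    ... | top _ = Vec.lookup y j
    ... | _     = Vec.lookup x j

    weight : Vector ℕ n
    weight j with role j
    ... | top _       = W
    ... | agree _ _   = suc W
    ... | low _ _     = 1

    topBonus : Vector ℕ n
    topBonus j with role j
    ... | top _ = W
    ... | _     = 0

    τ : V n → Vector ℕ n
    τ z j = gain (Vec.lookup z j) (preferred j) (weight j)

    F : V n → ℕ
    F = score weight preferred

    balance : ∀ j → τ x j + topBonus j ≡ τ y j + lowCount j
    balance j with role j
    ... | top refl    = trans (cong (_+ W) (gain-≢ W j*-differ))
                              (sym (trans (+-identityʳ _) (gain-≡ (Vec.lookup y j*) W)))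
    ... | agree _ x≡y = cong (λ b → gain b (Vec.lookup x j) (suc W) + 0) x≡y
    ... | low _ d     = trans (cong (_+ 0) (gain-≡ (Vec.lookup x j) 1))
                              (sym (cong (_+ 1) (gain-≢ 1 (d ∘ sym))))

    τ-≤-topBonus : ∀ z j → τ z j ≤ τ x j + topBonus j
    τ-≤-topBonus z j with role j
    ... | top refl  = ≤-trans (gain-≤ _ _ W) (m≤n+m W _)
    ... | agree _ _ = ≤-trans (gain-≤-gain-≡ (Vec.lookup z j) (Vec.lookup x j) (suc W)) (m≤m+n _ 0)
    ... | low _ _   = ≤-trans (gain-≤-gain-≡ (Vec.lookup z j) (Vec.lookup x j) 1) (m≤m+n _ 0)

    sum-topBonus : sum topBonus ≡ W
    sum-topBonus = trans (sum-single j* off-top) at-top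
      where
      off-top : ∀ j → j ≢ j* → topBonus j ≡ 0
      off-top j j≢j* with role j
      ... | top e     = contradiction e j≢j*
      ... | agree _ _ = refl
      ... | low _ _   = refl
      at-top : topBonus j* ≡ W
      at-top with role j*
      ... | top _      = refl
      ... | agree ne _ = contradiction refl ne
      ... | low ne _   = contradiction refl ne

    sum-τ+topBonus : ∀ z → sum (λ j → τ z j + topBonus j) ≡ sum (τ z) + W
    sum-τ+topBonus z = trans (∑-distrib-+ (τ z) topBonus) (cong (_+_ (sum (τ z))) sum-topBonus)

    F-x≡F-y : F x ≡ F y
    F-x≡F-y = +-cancelʳ-≡ W _ _ (begin
      sum (τ x) + W                       ≡⟨ sum-τ+topBonus x ⟨
      sum (λ j → τ x j + topBonus j)      ≡⟨ sum-cong-≗ balance ⟩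
      sum (λ j → τ y j + lowCount j)      ≡⟨ ∑-distrib-+ (τ y) lowCount ⟩
      sum (τ y) + W                       ∎)
      where open ≡-Reasoning

    AgreesWhereXY : V n → Set
    AgreesWhereXY z = ∀ j → Vec.lookup x j ≡ Vec.lookup y j → Vec.lookup z j ≡ Vec.lookup x j

    score-<-breaking-agreement : ∀ {z} j → Vec.lookup x j ≡ Vec.lookup y j →
                                 Vec.lookup z j ≢ Vec.lookup x j → F z < F x
    score-<-breaking-agreement {z} j x≡y z≢x = +-cancelʳ-≤ W (suc (sum (τ z))) (sum (τ x)) (begin
      suc (sum (τ z)) + W               ≡⟨ +-suc (sum (τ z)) W ⟨
      sum (τ z) + suc W                 ≤⟨ sum-mono-+-≤ j (τ-≤-topBonus z) at-j ⟩
      sum (λ j → τ x j + topBonus j)    ≡⟨ sum-τ+topBonus x ⟩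
      sum (τ x) + W                     ∎)
      where
      open ≤-Reasoning
      at-j : τ z j + suc W ≤ τ x j + topBonus j
      at-j with role j
      ... | top refl  = contradiction x≡y j*-differ
      ... | low _ d   = contradiction x≡y d
      ... | agree _ _ = ≤-reflexive (cong₂ _+_ (gain-≢ (suc W) z≢x)
                                      (trans (sym (gain-≡ _ (suc W))) (sym (+-identityʳ _))))

    score-<-keeping-top : ∀ {z} → z ≢ x → AgreesWhereXY z → Vec.lookup z j* ≡ Vec.lookup x j* →
                          F z < F x
    score-<-keeping-top {z} z≢x agrees z≡x-top with lam-top z≢x
    ... | j , _ , d = subst (_≤ sum (τ x)) (+-comm (sum (τ z)) 1) (sum-mono-+-≤ j τ-≤ at-j)
      where
      τ-≤ : ∀ j → τ z j ≤ τ x j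
      τ-≤ j with role j
      ... | top refl  = ≤-reflexive (trans (gain-≢ W (j*-differ ∘ trans (sym z≡x-top)))
                                           (sym (gain-≢ W j*-differ)))
      ... | agree _ _ = gain-≤-gain-≡ (Vec.lookup z j) (Vec.lookup x j) (suc W)
      ... | low _ _   = gain-≤-gain-≡ (Vec.lookup z j) (Vec.lookup x j) 1
      at-j : τ z j + 1 ≤ τ x j
      at-j with role j
      ... | top refl    = contradiction z≡x-top d
      ... | agree _ x≡y = contradiction (agrees j x≡y) d
      ... | low _ _     = ≤-reflexive (trans (cong (_+ 1) (gain-≢ 1 d)) (sym (gain-≡ _ 1)))

    closer-at-top : ∀ {z} → z ≢ y → AgreesWhereXY z → Vec.lookup z j* ≢ Vec.lookup x j* →
                    lam x z ≡ lam x y × ham x z < ham x y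
    closer-at-top {z} z≢y agrees z≢x-top with lam-top z≢y
    ... | j , _ , z≢y-at-j =
      lam-x-z , ham-< {x} {y} {z} differ-xy j x≢y-at-j (λ x≢z-at-j → x≢z-at-j x≡z-at-j)
      where
      x≢y-at-j : Differ x y j
      x≢y-at-j x≡y = z≢y-at-j (trans (agrees j x≡y) x≡y)
      x≡z-at-j : Vec.lookup x j ≡ Vec.lookup z j
      x≡z-at-j = trans (BoolP.¬-not x≢y-at-j) (sym (BoolP.¬-not z≢y-at-j))
      differ-xy : ∀ {j} → Differ x z j → Differ x y j
      differ-xy d x≡y = d (sym (agrees _ x≡y))
      lam-x-z : lam x z ≡ lam x y
      lam-x-z = ≤-antisym
        (agree⇒lam≤ x z λ j q → sym (agrees j (lam≤⇒agree x y ≤-refl j q)))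
        (subst (_≤ lam x z) (proj₁ (proj₂ (lam-top x≢y))) (differ⇒<lam x z (z≢x-top ∘ sym)))

    score-<-or-closer : ∀ {z} → z ≢ x → z ≢ y →
                        F z < F x ⊎ (lam x z ≡ lam x y × ham x z < ham x y)
    score-<-or-closer {z} z≢x z≢y
      with FinP.any? (λ j → (Vec.lookup x j BoolP.≟ Vec.lookup y j)
                      ×-dec ¬? (Vec.lookup z j BoolP.≟ Vec.lookup x j))
    ... | yes (j , x≡y , z≢x-at-j) = inj₁ (score-<-breaking-agreement {z} j x≡y z≢x-at-j)
    ... | no ¬breaks = by-top (Vec.lookup z j* BoolP.≟ Vec.lookup x j*)
      where
      agrees : AgreesWhereXY z
      agrees j x≡y = decidable-stable (Vec.lookup z j BoolP.≟ Vec.lookup x j)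
                                      (λ z≢x → ¬breaks (j , x≡y , z≢x))
      by-top : Dec (Vec.lookup z j* ≡ Vec.lookup x j*) →
               F z < F x ⊎ (lam x z ≡ lam x y × ham x z < ham x y)
      by-top (yes z≡x-top) = inj₁ (score-<-keeping-top {z} z≢x agrees z≡x-top)
      by-top (no z≢x-top)  = inj₂ (closer-at-top {z} z≢y agrees z≢x-top)

  nearest⇒skeletonEdge : ∀ {X : List (V n)} {x y} → x ∈ X → y ∈ X → x ≢ y →
    (∀ {z} → z ∈ X → z ≢ x → lam x z ≡ lam x y → ham x y ≤ ham x z) → SkeletonEdge X x y
  nearest⇒skeletonEdge {X} {x} {y} x∈X y∈X x≢y nearest =
    x∈X , y∈X , x≢y , functional weight preferred , dot≡⇐score≡ weight preferred F-x≡F-y ,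
    λ z z∈X z≢x z≢y → dot<⇐score< weight preferred (score-< z∈X z≢x z≢y)
    where
    open EdgeWitness x≢y
    score-< : ∀ {z} → z ∈ X → z ≢ x → z ≢ y → F z < F x
    score-< {z} z∈X z≢x z≢y with score-<-or-closer {z} z≢x z≢y
    ... | inj₁ lt            = lt
    ... | inj₂ (same-lam , closer) = contradiction (nearest z∈X z≢x same-lam) (<⇒≱ closer)

-- Branching, nearest sets and the stack

_∈ᴵ_ : ℕ → Interval → Set
m ∈ᴵ I = lo I ≤ m × m ≤ hi I

module Specification {n : ℕ} (X : List (V n)) where

  ∈-others⁺ : ∀ {x z} → z ∈ X → z ≢ x → z ∈ others X x
  ∈-others⁺ z∈X z≢x = ∈-filter⁺ (λ w → ¬? (w ≟V _)) z∈X z≢x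

  ∈-others⁻ : ∀ {x z} → z ∈ others X x → z ∈ X × z ≢ x
  ∈-others⁻ {x} p = ∈-filter⁻ (λ w → ¬? (w ≟V x)) {xs = X} p

  Attained : V n → ℕ → Set
  Attained x β = ∃[ z ] (z ∈ X × z ≢ x × lam x z ≡ β)

  LeastIn : V n → Interval → ℕ → Set
  LeastIn x I β = ∀ {z} → z ∈ X → z ≢ x → lam x z ∈ᴵ I → β ≤ lam x z

  candidates : V n → Interval → List ℕ
  candidates x I = filter (_∈I? I) (map (lam x) (others X x))

  ∈-candidates⁺ : ∀ {x z} I → z ∈ X → z ≢ x → lam x z ∈ᴵ I → lam x z ∈ candidates x I
  ∈-candidates⁺ {x} I z∈X z≢x = ∈-filter⁺ (_∈I? I) (∈-map⁺ (lam x) (∈-others⁺ z∈X z≢x))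

  data BranchingResult (x : V n) (I : Interval) (U : Stack) : Stack → Set where
    skip : (∀ {z} → z ∈ X → z ≢ x → ¬ lam x z ∈ᴵ I) → BranchingResult x I U U
    push : ∀ {β} → β ∈ᴵ I → Attained x β → LeastIn x I β → BranchingResult x I U ((I , β) ∷ U)

  branching-spec : ∀ x I U → BranchingResult x I U (branching X x I U)
  branching-spec x I U with candidates x I in eq
  ... | [] = skip λ {z} z∈X z≢x inI → ¬Any[] (subst (lam x z ∈_) eq (∈-candidates⁺ I z∈X z≢x inI))
  ... | b ∷ bs = push (proj₁ (source (foldr-⊓-∈ b bs))) (proj₂ (source (foldr-⊓-∈ b bs))) least
    where
    source : ∀ {a} → a ∈ b ∷ bs → a ∈ᴵ I × Attained x a
    source p with ∈-filter⁻ (_∈I? I) {xs = map (lam x) (others X x)} (subst (_ ∈_) (sym eq) p)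
    ... | q , inI with ∈-map⁻ (lam x) q
    ...   | z , z∈others , a≡ with ∈-others⁻ z∈others
    ...     | z∈X , z≢x = inI , z , z∈X , z≢x , sym a≡
    least : LeastIn x I (foldr _⊓_ b bs)
    least {z} z∈X z≢x inI = foldr-⊓-lower b bs (subst (lam x z ∈_) eq (∈-candidates⁺ I z∈X z≢x inI))

  sphere : V n → ℕ → List (V n)
  sphere x β = filter (λ y → lam x y ≟ β) (others X x)

  ∈-sphere⁺ : ∀ {x β z} → z ∈ X → z ≢ x → lam x z ≡ β → z ∈ sphere x β
  ∈-sphere⁺ {x} {β} z∈X z≢x = ∈-filter⁺ (λ y → lam x y ≟ β) (∈-others⁺ z∈X z≢x)

  ∈-sphere⁻ : ∀ {x β y} → y ∈ sphere x β → y ∈ X × y ≢ x × lam x y ≡ β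
  ∈-sphere⁻ {x} {β} p with ∈-filter⁻ (λ y → lam x y ≟ β) {xs = others X x} p
  ... | y∈others , lam≡ = proj₁ (∈-others⁻ y∈others) , proj₂ (∈-others⁻ y∈others) , lam≡

  closest : V n → V n → List (V n) → ℕ
  closest x m ms = foldr _⊓_ (ham x m) (map (ham x) ms)

  Nearest : V n → ℕ → V n → Set
  Nearest x β y = ∀ {z} → z ∈ X → z ≢ x → lam x z ≡ β → ham x y ≤ ham x z

  ∈-nearSet⁻ : ∀ {x β y} → y ∈ nearSet X x β → y ∈ X × y ≢ x × lam x y ≡ β × Nearest x β y
  ∈-nearSet⁻ {x} {β} {y} p with sphere x β in eq
  ∈-nearSet⁻ () | []
  ... | m ∷ ms with ∈-filter⁻ (λ y → ham x y ≟ closest x m ms) {xs = m ∷ ms} p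
  ...   | y∈ms , ham≡ with ∈-sphere⁻ (subst (y ∈_) (sym eq) y∈ms)
  ...     | y∈X , y≢x , lam≡ = y∈X , y≢x , lam≡ , nearest
    where
    nearest : Nearest x β y
    nearest {z} z∈X z≢x lam≡β = subst (_≤ ham x z) (sym ham≡) (foldr-⊓-lower (ham x m) (map (ham x) ms)
      (∈-map⁺ (ham x) (subst (z ∈_) eq (∈-sphere⁺ z∈X z≢x lam≡β))))

  nearSet-nonempty : ∀ {x β} → Attained x β → ∃[ w ] ∃[ ws ] nearSet X x β ≡ w ∷ ws
  nearSet-nonempty {x} {β} (z , z∈X , z≢x , lam≡β) with sphere x β in eq
  ... | [] = contradiction (subst (z ∈_) eq (∈-sphere⁺ z∈X z≢x lam≡β)) λ ()
  ... | m ∷ ms with ∈-map⁻ (ham x) (foldr-⊓-∈ (ham x m) (map (ham x) ms))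
  ...   | u , u∈ , ham≡ = nonempty (∈-filter⁺ (λ y → ham x y ≟ closest x m ms) u∈ (sym ham≡))
    where
    nonempty : ∀ {A : Set} {a : A} {xs} → a ∈ xs → ∃[ w ] ∃[ ws ] xs ≡ w ∷ ws
    nonempty {xs = w ∷ ws} _ = w , ws , refl

InStack : Stack → ℕ → Set
InStack U m = Any (λ e → m ∈ᴵ proj₁ e) U

Below : ℕ → Stack → Set
Below h U = All (λ e → h < lo (proj₁ e)) U

below⇒< : ∀ {h m U} → Below h U → InStack U m → h < m
below⇒< = All.lookupWith λ h<lo inI → <-≤-trans h<lo (proj₁ inI)

below-weaken : ∀ {h h′ U} → h′ ≤ h → Below h U → Below h′ U
below-weaken h′≤h = All.map (≤-<-trans h′≤h)

module Stacks {n : ℕ} (X : List (V n)) where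
  open Specification X

  record ValidEntry (x : V n) (e : Interval × ℕ) : Set where
    field
      positive : 1 ≤ lo (proj₁ e)
      inside   : proj₂ e ∈ᴵ proj₁ e
      attained : Attained x (proj₂ e)
      least    : LeastIn x (proj₁ e) (proj₂ e)

  WellFormed : V n → Stack → Set
  WellFormed x U = All (ValidEntry x) U × AllPairs (λ e f → hi (proj₁ e) < lo (proj₁ f)) U

  valid-move : ∀ {x y e} → lam x y < lo (proj₁ e) → ValidEntry x e → ValidEntry y e
  valid-move {x} {y} {I , b} lam<lo v = record
    { positive = positive
    ; inside   = inside
    ; attained = z , z∈X , z≢y , trans (lam-far x y z far) lam≡b
    ; least    = least′
    }
    where
    open ValidEntry v
    z : V n
    z = proj₁ attained
    z∈X : z ∈ X
    z∈X = proj₁ (proj₂ attained)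
    lam≡b : lam x z ≡ b
    lam≡b = proj₂ (proj₂ (proj₂ attained))
    far : lam x y < lam x z
    far = <-≤-trans lam<lo (subst (lo I ≤_) (sym lam≡b) (proj₁ inside))
    z≢y : z ≢ y
    z≢y refl = <-irrefl refl far
    least′ : LeastIn y I b
    least′ {z} z∈X z≢y inI = subst (b ≤_) lam≡ (least z∈X z≢x (subst (_∈ᴵ I) (sym lam≡) inI))
      where
      far′ : lam x y < lam y z
      far′ = <-≤-trans lam<lo (proj₁ inI)
      lam≡ : lam x z ≡ lam y z
      lam≡ = lam-isosceles x y z far′
      z≢x : z ≢ x
      z≢x refl = <-irrefl (lam-sym x y) far′

  valid-all-move : ∀ {x y U} → Below (lam x y) U → All (ValidEntry x) U → All (ValidEntry y) U
  valid-all-move below valid = All.zipWith (λ (lt , v) → valid-move lt v) (below , valid)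

  inStack-branching : ∀ {y z} I U → z ∈ X → z ≢ y →
    InStack (branching X y I U) (lam y z) ⇔ (lam y z ∈ᴵ I ⊎ InStack U (lam y z))
  inStack-branching {y} I U z∈X z≢y with branching X y I U | branching-spec y I U
  ... | _ | skip none  = mk⇔ inj₂ [ (λ inI → contradiction inI (none z∈X z≢y)) , id ]′
  ... | _ | push _ _ _ = mk⇔ (λ { (here inI) → inj₁ inI ; (there s) → inj₂ s }) [ here , there ]′

  wellFormed-branching : ∀ {y} J U → 1 ≤ lo J → Below (hi J) U →
                         WellFormed y U → WellFormed y (branching X y J U)
  wellFormed-branching {y} J U 1≤lo below wf with branching X y J U | branching-spec y J U
  ... | _ | skip _ = wf
  ... | _ | push inside attained least =
    record { positive = 1≤lo ; inside = inside ; attained = attained ; least = least } ∷ proj₁ wf ,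
    below ∷ proj₂ wf

  below-branching : ∀ {h y} J U → h < lo J → Below h U → Below h (branching X y J U)
  below-branching {y = y} J U h<lo below with branching X y J U | branching-spec y J U
  ... | _ | skip _     = below
  ... | _ | push _ _ _ = h<lo ∷ below

-- Genlex orders

LamNondecreasing : ∀ {n} → List (V n) → Set
LamNondecreasing S = ∀ {i j l u v w} → i ≤ j → j ≤ l →
  S [ i ]= u → S [ j ]= v → S [ l ]= w → lam u v ≤ lam u w

lamNondecreasing⇒genlex : ∀ {n} {P : List (V n)} → LamNondecreasing P → Genlex P
lamNondecreasing⇒genlex {P = P} mono k i j l i≤j j≤l same =
  lam≤⇒agree (lookup P i) (lookup P j)
    (≤-trans (mono i≤j j≤l ([]=-lookup P i) ([]=-lookup P j) ([]=-lookup P l))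
             (agree⇒lam≤ (lookup P i) (lookup P l) same))

module _ {n : ℕ} (X : List (V n)) where

  UnvisitedFarther : List (V n) → Set
  UnvisitedFarther S = ∀ {i j u v z} → i ≤ j → S [ i ]= u → S [ j ]= v →
    z ∈ X → z ∉ S → lam u v ≤ lam u z

  nondecreasing-∷ʳ : ∀ S {y} → LamNondecreasing S → UnvisitedFarther S → y ∈ X → y ∉ S →
                     LamNondecreasing (S ∷ʳ y)
  nondecreasing-∷ʳ S {y} mono farther y∈X y∉S i≤j j≤l at-i at-j at-l with []=-∷ʳ⁻ S at-l
  ... | inj₁ at-l′ = mono i≤j j≤l (init at-i (≤-<-trans i≤j (≤-<-trans j≤l ([]=⇒< at-l′))))
                                  (init at-j (≤-<-trans j≤l ([]=⇒< at-l′))) at-l′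
    where
    init : ∀ {i a} → (S ∷ʳ y) [ i ]= a → i < length S → S [ i ]= a
    init = []=-∷ʳ-init S
  ... | inj₂ (refl , refl) with []=-∷ʳ⁻ S at-j
  ...   | inj₂ (_ , refl) = ≤-refl
  ...   | inj₁ at-j′ = farther i≤j ([]=-∷ʳ-init S at-i (≤-<-trans i≤j ([]=⇒< at-j′))) at-j′ y∈X y∉S

  farther-∷ʳ : ∀ T {x y} → UnvisitedFarther (T ∷ʳ x) →
               (∀ {z} → z ∈ X → z ∉ T ∷ʳ x → lam x y ≤ lam x z) → UnvisitedFarther (T ∷ʳ x ∷ʳ y)
  farther-∷ʳ T {x} {y} farther y-nearest {u = u} {z = z} i≤j at-i at-j z∈X z∉S′
    with []=-∷ʳ⁻ (T ∷ʳ x) at-j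
  ... | inj₁ at-j′ =
    farther i≤j ([]=-∷ʳ-init (T ∷ʳ x) at-i (≤-<-trans i≤j ([]=⇒< at-j′))) at-j′ z∈X z∉S
    where
    z∉S : z ∉ T ∷ʳ x
    z∉S = z∉S′ ∘ ∈-++⁺ˡ
  ... | inj₂ (refl , refl) with []=-∷ʳ⁻ (T ∷ʳ x) at-i
  ...   | inj₂ (_ , refl) = subst (_≤ lam y z) (sym (lam-self y)) z≤n
  ...   | inj₁ at-i′ = lam-≤-via u x y z (farther ([]=-∷ʳ-≤ T at-i′) at-i′ ([]=-last T) z∈X z∉S)
                                     (y-nearest z∈X z∉S)
    where
    z∉S : z ∉ T ∷ʳ x
    z∉S = z∉S′ ∘ ∈-++⁺ˡ

-- Correctness of Algorithm P*

module Run {n : ℕ} (X : List (V n)) (x̃ : V n) where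
  open import Data.List.Membership.DecPropositional (_≟V_ {n}) using (_∈?_)
  open Specification X
  open Stacks X

  record Invariant (T : List (V n)) (x : V n) (U : Stack) : Set where
    field
      unique        : Unique (T ∷ʳ x)
      visited⊆X     : ∀ {z} → z ∈ T ∷ʳ x → z ∈ X
      starts        : ∃[ P′ ] T ∷ʳ x ≡ x̃ ∷ P′
      linked        : Linked (SkeletonEdge X) (T ∷ʳ x)
      nondecreasing : LamNondecreasing (T ∷ʳ x)
      farther       : UnvisitedFarther X (T ∷ʳ x)
      pending       : ∀ {z} → z ∈ X → z ≢ x → (z ∉ T ∷ʳ x) ⇔ InStack U (lam x z)
      wellFormed    : WellFormed x U

  module Step {T x I β U} (inv : Invariant T x ((I , β) ∷ U)) {y} (y∈N : y ∈ nearSet X x β) where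
    open Invariant inv

    S : List (V n)
    S = T ∷ʳ x
    J : Interval
    J = minusUpto I β
    U₁ U′ : Stack
    U₁ = branching X y J U
    U′ = branching X y (upto (β ∸ 1)) U₁

    y∈X : y ∈ X
    y∈X = proj₁ (∈-nearSet⁻ y∈N)
    y≢x : y ≢ x
    y≢x = proj₁ (proj₂ (∈-nearSet⁻ y∈N))
    lam-xy : lam x y ≡ β
    lam-xy = proj₁ (proj₂ (proj₂ (∈-nearSet⁻ y∈N)))
    nearest : Nearest x β y
    nearest = proj₂ (proj₂ (proj₂ (∈-nearSet⁻ y∈N)))

    top : ValidEntry x (I , β)
    top = All.head (proj₁ wellFormed)
    open ValidEntry top using (inside; least)

    below-I : Below (hi I) U
    below-I = AllPairs.head (proj₂ wellFormed)

    β≥1 : 1 ≤ β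
    β≥1 = ≤-trans (ValidEntry.positive top) (proj₁ inside)

    β<lo-J : β < lo J
    β<lo-J = m≤n⊔m (lo I) (suc β)

    x∈S : x ∈ S
    x∈S = ∈-++⁺ʳ T (here refl)

    ∉S⇒≢x : ∀ {z} → z ∉ S → z ≢ x
    ∉S⇒≢x z∉S refl = z∉S x∈S

    y∉S : y ∉ S
    y∉S = from (pending y∈X y≢x) (here (subst (_∈ᴵ I) (sym lam-xy) inside))

    β≤unvisited : ∀ {z} → z ∈ X → z ∉ S → β ≤ lam x z
    β≤unvisited z∈X z∉S with to (pending z∈X (∉S⇒≢x z∉S)) z∉S
    ... | here inI = least z∈X (∉S⇒≢x z∉S) inI
    ... | there s  = <⇒≤ (≤-<-trans (proj₂ inside) (below⇒< below-I s))

    inStack-U′ : ∀ {z} → z ∈ X → z ≢ y →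
      InStack U′ (lam y z) ⇔ (lam y z ∈ᴵ upto (β ∸ 1) ⊎ lam y z ∈ᴵ J ⊎ InStack U (lam y z))
    inStack-U′ z∈X z≢y = ⇔.trans (inStack-branching (upto (β ∸ 1)) U₁ z∈X z≢y)
                                  (⇔.refl ⊎-⇔ inStack-branching J U z∈X z≢y)

    β∉U′ : ∀ {z} → z ∈ X → z ≢ y → lam y z ≡ β → ¬ InStack U′ (lam y z)
    β∉U′ z∈X z≢y lam≡β s with to (inStack-U′ z∈X z≢y) s
    ... | inj₁ (_ , ≤β∸1)      = <⇒≱ (∸-monoʳ-< {o = 0} (s≤s z≤n) β≥1) (subst (_≤ β ∸ 1) lam≡β ≤β∸1)
    ... | inj₂ (inj₁ (lo≤ , _)) = <⇒≱ β<lo-J (subst (lo J ≤_) lam≡β lo≤)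
    ... | inj₂ (inj₂ s′)        = <⇒≱ (below⇒< below-I s′) (subst (_≤ hi I) (sym lam≡β) (proj₂ inside))

    pending-closer : ∀ {z} → z ∈ X → z ≢ y → lam x z < β → (z ∉ S ∷ʳ y) ⇔ InStack U′ (lam y z)
    pending-closer {z} z∈X z≢y lt = mk⇔
      (λ z∉S′ → contradiction (β≤unvisited z∈X (z∉S′ ∘ ∈-++⁺ˡ)) (<⇒≱ lt))
      (λ s → contradiction s (β∉U′ z∈X z≢y lam-yz))
      where
      lam-yz : lam y z ≡ β
      lam-yz = trans (lam-sym y z) (trans (lam-isosceles z x y zx<xy) lam-xy)
        where
        zx<xy : lam z x < lam x y
        zx<xy = subst₂ _<_ (lam-sym x z) (sym lam-xy) lt

    pending-same : ∀ {z} → z ∈ X → z ≢ y → lam x z ≡ β → (z ∉ S ∷ʳ y) ⇔ InStack U′ (lam y z)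
    pending-same {z} z∈X z≢y lam≡β = mk⇔
      (λ _ → from (inStack-U′ z∈X z≢y) (inj₁ (lam-pos (z≢y ∘ sym) , ∸-monoˡ-≤ 1 lam-yz<β)))
      (λ _ → ∉-∷ʳ z∉S z≢y)
      where
      z≢x : z ≢ x
      z≢x refl = <⇒≱ β≥1 (≤-reflexive (trans (sym lam≡β) (lam-self x)))
      z∉S : z ∉ S
      z∉S = from (pending z∈X z≢x) (here (subst (_∈ᴵ I) (sym lam≡β) inside))
      lam-yz<β : lam y z < β
      lam-yz<β = subst (lam y z <_) lam-xy
        (lam-binary (y≢x ∘ sym) (z≢x ∘ sym) (trans lam-xy (sym lam≡β)))

    pending-farther : ∀ {z} → z ∈ X → z ≢ y → β < lam x z → (z ∉ S ∷ʳ y) ⇔ InStack U′ (lam y z)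
    pending-farther {z} z∈X z≢y β< = mk⇔ to′ from′
      where
      lam-yz : lam y z ≡ lam x z
      lam-yz = lam-far x y z (subst (_< lam x z) (sym lam-xy) β<)
      z≢x : z ≢ x
      z≢x refl = <⇒≱ β< (subst (_≤ β) (sym (lam-self x)) z≤n)
      to′ : z ∉ S ∷ʳ y → InStack U′ (lam y z)
      to′ z∉S′ with to (pending z∈X z≢x) (z∉S′ ∘ ∈-++⁺ˡ)
      ... | here (lo≤ , ≤hi) = from (inStack-U′ z∈X z≢y) (inj₂ (inj₁
              (subst (lo J ≤_) (sym lam-yz) (⊔-lub lo≤ β<) , subst (_≤ hi I) (sym lam-yz) ≤hi)))
      ... | there s = from (inStack-U′ z∈X z≢y) (inj₂ (inj₂ (subst (InStack U) (sym lam-yz) s)))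
      from′ : InStack U′ (lam y z) → z ∉ S ∷ʳ y
      from′ s with to (inStack-U′ z∈X z≢y) s
      ... | inj₁ (_ , ≤β∸1) =
              contradiction (≤-trans (subst (_≤ β ∸ 1) lam-yz ≤β∸1) (m∸n≤m β 1)) (<⇒≱ β<)
      ... | inj₂ (inj₁ (lo≤ , ≤hi)) = ∉-∷ʳ (from (pending z∈X z≢x) (here
              (≤-trans (m≤m⊔n (lo I) (suc β)) (subst (lo J ≤_) lam-yz lo≤) , subst (_≤ hi I) lam-yz ≤hi))) z≢y
      ... | inj₂ (inj₂ s′) = ∉-∷ʳ (from (pending z∈X z≢x) (there (subst (InStack U) lam-yz s′))) z≢y

    edge : SkeletonEdge X x y
    edge = nearest⇒skeletonEdge (visited⊆X x∈S) y∈X (y≢x ∘ sym)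
             λ z∈X z≢x lam≡ → nearest z∈X z≢x (trans lam≡ lam-xy)

    wellFormed′ : WellFormed y U′
    wellFormed′ = wellFormed-branching (upto (β ∸ 1)) U₁ (s≤s z≤n) below-U₁
      (wellFormed-branching J U (≤-trans (s≤s z≤n) β<lo-J) below-I
        (valid-all-move (below-weaken (≤-trans (≤-reflexive lam-xy) (proj₂ inside)) below-I)
                        (All.tail (proj₁ wellFormed)) ,
         AllPairs.tail (proj₂ wellFormed)))
      where
      below-U₁ : Below (β ∸ 1) U₁
      below-U₁ = below-branching J U (<-≤-trans (s≤s (m∸n≤m β 1)) β<lo-J)
                   (below-weaken (≤-trans (m∸n≤m β 1) (proj₂ inside)) below-I)

    pending′ : ∀ {z} → z ∈ X → z ≢ y → (z ∉ S ∷ʳ y) ⇔ InStack U′ (lam y z)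
    pending′ {z} z∈X z≢y with <-cmp (lam x z) β
    ... | tri< lt _ _ = pending-closer z∈X z≢y lt
    ... | tri≈ _ e _  = pending-same z∈X z≢y e
    ... | tri> _ _ gt = pending-farther z∈X z≢y gt

    visited⊆X′ : ∀ {z} → z ∈ S ∷ʳ y → z ∈ X
    visited⊆X′ p with ∈-++⁻ S p
    ... | inj₁ z∈S         = visited⊆X z∈S
    ... | inj₂ (here refl) = y∈X

    invariant : Invariant S y U′
    invariant = record
      { unique        = Unique.++⁺ unique (All.[] ∷ []) λ { (y∈S , here refl) → y∉S y∈S }
      ; visited⊆X     = visited⊆X′
      ; starts        = proj₁ starts ∷ʳ y , cong (_∷ʳ y) (proj₂ starts)
      ; linked        = Linked-∷ʳ T linked edge
      ; nondecreasing = nondecreasing-∷ʳ X S nondecreasing farther y∈X y∉S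
      ; farther       = farther-∷ʳ X T farther λ z∈X z∉S → subst (_≤ _) (sym lam-xy) (β≤unvisited z∈X z∉S)
      ; pending       = pending′
      ; wellFormed    = wellFormed′
      }

  unvisited : List (V n) → ℕ
  unvisited S = length (filter (λ z → ¬? (z ∈? S)) X)

  unvisited-∷ʳ : ∀ S {y} → y ∈ X → y ∉ S → unvisited (S ∷ʳ y) < unvisited S
  unvisited-∷ʳ S {y} y∈X y∉S = length-filter-mono-< (λ z → ¬? (z ∈? (S ∷ʳ y))) (λ z → ¬? (z ∈? S))
    (λ z∉S′ z∈S → z∉S′ (∈-++⁺ˡ z∈S)) X y∈X y∉S (λ y∉S′ → y∉S′ (∈-++⁺ʳ S (here refl)))

  initial : x̃ ∈ X → Invariant [] x̃ (branching X x̃ (upto n) [])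
  initial x̃∈X = record
    { unique        = All.[] ∷ []
    ; visited⊆X     = λ { (here refl) → x̃∈X }
    ; starts        = [] , refl
    ; linked        = [-]
    ; nondecreasing = λ { _ _ at0 at0 at0 → ≤-refl }
    ; farther       = λ { {z = z} _ at0 at0 _ _ → subst (_≤ lam x̃ z) (sym (lam-self x̃)) z≤n }
    ; pending       = λ {z} z∈X z≢x̃ → mk⇔
        (λ _ → from (inStack-branching (upto n) [] z∈X z≢x̃) (inj₁ (lam-pos (z≢x̃ ∘ sym) , lam≤n x̃ z)))
        (λ { _ (here z≡x̃) → z≢x̃ z≡x̃ })
    ; wellFormed    = wellFormed-branching (upto n) [] (s≤s z≤n) All.[] (All.[] , AllPairs.[])
    }

  Correct : Maybe (List (V n)) → Set
  Correct r = ∃[ P ] ∃[ P′ ] (r ≡ just P × P ≡ x̃ ∷ P′ × HamiltonPath X P × Genlex P)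

  finished : ∀ {T x} → Invariant T x [] → HamiltonPath X (T ∷ʳ x) × Genlex (T ∷ʳ x)
  finished {T} {x} inv =
    (unique , (λ _ → visited⊆X) , covers , linked) , lamNondecreasing⇒genlex nondecreasing
    where
    open Invariant inv
    covers : ∀ z → z ∈ X → z ∈ T ∷ʳ x
    covers z z∈X with z ≟V x | z ∈? T ∷ʳ x
    ... | yes refl | _       = ∈-++⁺ʳ T (here refl)
    ... | no _     | yes z∈S = z∈S
    ... | no z≢x   | no z∉S  = contradiction (to (pending z∈X z≢x) z∉S) ¬Any[]

  module _ (rule : Rule n) (valid : ValidRule rule) where

    loop-correct : ∀ k acc x U → Invariant (reverse acc) x U → unvisited (reverse acc ∷ʳ x) < k →
                   Correct (loopP X rule k acc x U)
    loop-correct (suc k) acc x [] inv _ =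
      reverse (x ∷ acc) , proj₁ (Invariant.starts inv) ,
      refl , trans (unfold-reverse x acc) (proj₂ (Invariant.starts inv)) ,
      subst (λ P → HamiltonPath X P × Genlex P) (sym (unfold-reverse x acc)) (finished inv)
    loop-correct (suc k) acc x ((I , β) ∷ U) inv bound
      with nearSet-nonempty (ValidEntry.attained (All.head (proj₁ (Invariant.wellFormed inv))))
    ... | w , ws , eq rewrite eq = loop-correct k (x ∷ acc) y _ invariant′ bound′
      where
      y : V n
      y = rule (mkState (reverse (x ∷ acc)) x I β U) (w ∷ ws)
      open Step inv (subst (y ∈_) (sym eq) (valid _ w ws))
      invariant′ : Invariant (reverse (x ∷ acc)) y U′
      invariant′ = subst (λ T → Invariant T y U′) (sym (unfold-reverse x acc)) invariant
      bound′ : unvisited (reverse (x ∷ acc) ∷ʳ y) < k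
      bound′ = subst (λ T → unvisited (T ∷ʳ y) < k) (sym (unfold-reverse x acc))
                     (≤-trans (unvisited-∷ʳ S y∈X y∉S) (s≤s⁻¹ bound))

theorem17 : (n : ℕ) (X : List (V n)) → X ≢ [] →
    (rule : Rule n) → ValidRule rule →
    (x̃ : V n) → x̃ ∈ X →
    ∃[ fuel ] ∃[ P ] ∃[ P' ]
    (algorithmP* X rule x̃ fuel ≡ just P × P ≡ x̃ ∷ P' × HamiltonPath X P × Genlex P)
-- X ≢ [] is implied by x̃ ∈ X.
theorem17 n X _ rule valid x̃ x̃∈X =
  suc (length X) ,
  loop-correct rule valid (suc (length X)) [] x̃ _ (initial x̃∈X) (s≤s (length-filter _ X))
  where
  open Run X x̃
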